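{- Let $S$ be a finite set, let $\mathcal{V}\le\mathcal{P}(S)$ have dimension $r$, and let $\mathscr{X}=(X_1,\dots,X_r)$ and $\mathscr{Y}=(Y_1,\dots,Y_r)$ be bases of $\mathcal{V}$. Let $M$ be the invertible $r\times r$ matrix over $\mathbb{F}_2$ with $z_{\mathscr{X}}(\vec b)=z_{\mathscr{Y}}(M\vec b)$ for all $\vec b\in\mathbb{F}_2^r$. Then $v_{\mathscr{X}}(\vec a)=v_{\mathscr{Y}}((M^T)^{ -1}\vec a)$ for all $\vec a\in\mathbb{F}_2^r$.
   Context: $\mathcal{P}(S)$ is an $\mathbb{F}_2$-vector space under symmetric difference $\triangle$. For a basis $\mathscr{X}=(X_1,\dots,X_r)$ of $\mathcal{V}$ and $\vec a\in\mathbb{F}_2^r$ with support $I_{\vec a}=\{i:a_i=1\}$: $z_{\mathscr{X}}(\vec a)=\triangle_{i\in I_{\vec a}}X_i$ (equal to $\varnothing$ if $\vec a=\vec 0$), and $v_{\mathscr{X}}(\vec a)=\bigcap_{i\in I_{\vec a}}X_i\cap\bigcap_{i\notin I_{\vec a}}(S\setminus X_i)$ (the Venn region indexed by $\vec a$). -}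

module Defs where

open import Data.Nat using (ℕ)
open import Data.Bool using (Bool; true; false; _xor_; _∧_; if_then_else_)
open import Data.Fin using (Fin)
open import Data.Vec using (Vec; zipWith)
open import Data.Fin.Subset using (Subset; ⊥; ⊤; _∩_; ∁)
open import Data.Product using (Σ; _×_; ∃)
open import Relation.Nullary.Decidable.Core using (does)
import Data.Fin
open import Relation.Binary.PropositionalEquality using (_≡_)

-- 𝔽₂ is Bool with xor as addition and ∧ as multiplication.
-- 𝔽₂^r is represented as functions Fin r → Bool.
F2Vec : ℕ → Set
F2Vec r = Fin r → Bool

-- r×r matrices over 𝔽₂, M i j = entry in row i, column j.
F2Mat : ℕ → Set
F2Mat r = Fin r → Fin r → Bool

sumF2 : ∀ {r} → (Fin r → Bool) → Bool
sumF2 {ℕ.zero}  f = false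
sumF2 {ℕ.suc r} f = f Fin.zero xor sumF2 (λ i → f (Fin.suc i))

_·ᵥ_ : ∀ {r} → F2Mat r → F2Vec r → F2Vec r
(M ·ᵥ b) i = sumF2 (λ j → M i j ∧ b j)

_·ₘ_ : ∀ {r} → F2Mat r → F2Mat r → F2Mat r
(A ·ₘ B) i k = sumF2 (λ j → A i j ∧ B j k)

idMat : ∀ {r} → F2Mat r
idMat i j = does (i Data.Fin.≟ j)

transpose : ∀ {r} → F2Mat r → F2Mat r
transpose M i j = M j i

_△_ : ∀ {n} → Subset n → Subset n → Subset n
_△_ = zipWith _xor_

bigSymDiff : ∀ {n r} → (Fin r → Subset n) → (Fin r → Bool) → Subset n
bigSymDiff {n} {ℕ.zero}  X a = ⊥
bigSymDiff {n} {ℕ.suc r} X a =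
  (if a Fin.zero then X Fin.zero else ⊥) △ bigSymDiff (λ i → X (Fin.suc i)) (λ i → a (Fin.suc i))

bigVenn : ∀ {n r} → (Fin r → Subset n) → (Fin r → Bool) → Subset n
bigVenn {n} {ℕ.zero}  X a = ⊤
bigVenn {n} {ℕ.suc r} X a =
  (if a Fin.zero then X Fin.zero else ∁ (X Fin.zero)) ∩ bigVenn (λ i → X (Fin.suc i)) (λ i → a (Fin.suc i))

z : ∀ {n r} → (Fin r → Subset n) → F2Vec r → Subset n
z = bigSymDiff

v : ∀ {n r} → (Fin r → Subset n) → F2Vec r → Subset n
v = bigVenn

IsSubspace : ∀ {n} → (Subset n → Set) → Set
IsSubspace {n} V = V ⊥ × (∀ A B → V A → V B → V (A △ B))

IsBasis : ∀ {n r} → (Subset n → Set) → (Fin r → Subset n) → Set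
IsBasis {n} {r} V X =
  (∀ i → V (X i)) ×
  (∀ (a : F2Vec r) → z X a ≡ ⊥ → ∀ i → a i ≡ false) ×
  (∀ A → V A → ∃ λ (a : F2Vec r) → z X a ≡ A)

_≈ₘ_ : ∀ {r} → F2Mat r → F2Mat r → Set
A ≈ₘ B = ∀ i j → A i j ≡ B i j

IsInverse : ∀ {r} → F2Mat r → F2Mat r → Set
IsInverse M Minv = ((M ·ₘ Minv) ≈ₘ idMat) × ((Minv ·ₘ M) ≈ₘ idMat)

-- A point s ∈ S lies in the Venn region v_𝒳(a) exactly when its incidence
-- vector x_s = (s ∈ X_i)_i equals a, and membership in a symmetric difference
-- is a sum over 𝔽₂, so s ∈ z_𝒳(b) iff ⟨b, x_s⟩ = 1. Evaluating the hypothesis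
-- z_𝒳(e_j) = z_𝒴(M e_j) at s gives x_s = Mᵀ y_s, and Mᵀ y_s = a iff
-- y_s = (Mᵀ)⁻¹ a = (M⁻¹)ᵀ a.
module Submission where

open import Defs
open import Data.Nat using (ℕ)
open import Data.Fin using (Fin)
open import Data.Fin.Subset using (Subset)
open import Data.Product using (_×_)
open import Relation.Binary.PropositionalEquality using (_≡_)

open import Algebra.Bundles using (CommutativeRing)
open import Data.Bool using (Bool; true; false; _xor_; _∧_; not; if_then_else_)
open import Data.Bool.Properties
  using (∧-comm; ∧-assoc; ∧-zeroʳ; ∧-distribˡ-xor; xor-identityʳ; ⇔→≡; xor-∧-commutativeRing)
open import Data.Fin using (zero; suc; _≟_)
open import Data.Fin.Properties using (∀-cons-⇔)
import Data.Fin.Subset as Subset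
open import Data.Product using (_,_)
open import Data.Product.Function.NonDependent.Propositional using (_×-⇔_)
open import Data.Vec using (lookup)
open import Data.Vec.Properties using (lookup-zipWith; lookup-map; lookup-replicate)
open import Data.Vec.Relation.Binary.Pointwise.Extensional using (ext; Pointwise-≡⇒≡)
open import Function using (_∘_)
open import Function.Bundles using (_⇔_; mk⇔)
open import Function.Related.Propositional using (module EquationalReasoning)
open import Function.Construct.Composition using (_⇔-∘_)
open import Function.Construct.Symmetry using (⇔-sym)
open import Relation.Binary.PropositionalEquality
  using (_≗_; refl; sym; trans; cong; cong₂; module ≡-Reasoning)
open import Relation.Nullary using (yes; no)
open import Algebra.Properties.CommutativeSemigroup
  (CommutativeRing.+-commutativeSemigroup xor-∧-commutativeRing) using (interchange)

private
  variable
    n r : ℕ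

sumF2-cong : {f g : Fin r → Bool} → f ≗ g → sumF2 f ≡ sumF2 g
sumF2-cong {ℕ.zero}  f≗g = refl
sumF2-cong {ℕ.suc r} f≗g = cong₂ _xor_ (f≗g zero) (sumF2-cong (f≗g ∘ suc))

sumF2-false : ∀ r → sumF2 {r} (λ _ → false) ≡ false
sumF2-false ℕ.zero    = refl
sumF2-false (ℕ.suc r) = sumF2-false r

sumF2-xor : (f g : Fin r → Bool) → sumF2 (λ i → f i xor g i) ≡ sumF2 f xor sumF2 g
sumF2-xor {ℕ.zero}  f g = refl
sumF2-xor {ℕ.suc r} f g =
  trans (cong ((f zero xor g zero) xor_) (sumF2-xor (f ∘ suc) (g ∘ suc)))
        (interchange (f zero) (g zero) _ _)

∧-distribˡ-sumF2 : ∀ c (f : Fin r → Bool) → c ∧ sumF2 f ≡ sumF2 (λ i → c ∧ f i)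
∧-distribˡ-sumF2 {ℕ.zero}  c f = ∧-zeroʳ c
∧-distribˡ-sumF2 {ℕ.suc r} c f =
  trans (∧-distribˡ-xor c (f zero) _) (cong ((c ∧ f zero) xor_) (∧-distribˡ-sumF2 c (f ∘ suc)))

∧-distribʳ-sumF2 : ∀ c (f : Fin r → Bool) → sumF2 f ∧ c ≡ sumF2 (λ i → f i ∧ c)
∧-distribʳ-sumF2 c f =
  trans (∧-comm _ c) (trans (∧-distribˡ-sumF2 c f) (sumF2-cong (λ i → ∧-comm c (f i))))

sumF2-comm : ∀ {s} (f : Fin r → Fin s → Bool) →
  sumF2 (λ i → sumF2 (f i)) ≡ sumF2 (λ j → sumF2 (λ i → f i j))
sumF2-comm {ℕ.zero} {s} f = sym (sumF2-false s)
sumF2-comm {ℕ.suc r} f =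
  trans (cong (sumF2 (f zero) xor_) (sumF2-comm (f ∘ suc)))
        (sym (sumF2-xor (f zero) (λ j → sumF2 (λ i → f (suc i) j))))

sumF2-idMat : (k : Fin r) (g : Fin r → Bool) → sumF2 (λ i → idMat i k ∧ g i) ≡ g k
sumF2-idMat {ℕ.suc r} zero g =
  trans (cong (g zero xor_) (sumF2-false r)) (xor-identityʳ (g zero))
sumF2-idMat {ℕ.suc r} (suc k) g = trans (sumF2-cong idMat-suc) (sumF2-idMat k (g ∘ suc))
  where
  idMat-suc : ∀ i → idMat (suc i) (suc k) ∧ g (suc i) ≡ idMat i k ∧ g (suc i)
  idMat-suc i with i ≟ k
  ... | yes _ = refl
  ... | no _  = refl

·ᵥ-cong : (A : F2Mat r) {x y : F2Vec r} → x ≗ y → A ·ᵥ x ≗ A ·ᵥ y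
·ᵥ-cong A x≗y i = sumF2-cong (λ j → cong (A i j ∧_) (x≗y j))

transpose-·ᵥ-·ₘ : (A B : F2Mat r) (x : F2Vec r) →
  transpose A ·ᵥ (transpose B ·ᵥ x) ≗ transpose (B ·ₘ A) ·ᵥ x
transpose-·ᵥ-·ₘ A B x k = begin
  sumF2 (λ j → A j k ∧ sumF2 (λ i → B i j ∧ x i))
    ≡⟨ sumF2-cong (λ j → trans (∧-distribˡ-sumF2 (A j k) (λ i → B i j ∧ x i)) (sumF2-cong (reassoc j))) ⟩
  sumF2 (λ j → sumF2 (λ i → (B i j ∧ A j k) ∧ x i))
    ≡⟨ sumF2-comm (λ j i → (B i j ∧ A j k) ∧ x i) ⟩
  sumF2 (λ i → sumF2 (λ j → (B i j ∧ A j k) ∧ x i))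
    ≡⟨ sumF2-cong (λ i → sym (∧-distribʳ-sumF2 (x i) (λ j → B i j ∧ A j k))) ⟩
  sumF2 (λ i → (B ·ₘ A) i k ∧ x i) ∎
  where
  open ≡-Reasoning
  reassoc : ∀ j i → A j k ∧ (B i j ∧ x i) ≡ (B i j ∧ A j k) ∧ x i
  reassoc j i = trans (sym (∧-assoc (A j k) (B i j) (x i))) (cong (_∧ x i) (∧-comm (A j k) (B i j)))

transpose-·ᵥ-cancel : (A B : F2Mat r) → (B ·ₘ A) ≈ₘ idMat → (x : F2Vec r) →
  transpose A ·ᵥ (transpose B ·ᵥ x) ≗ x
transpose-·ᵥ-cancel A B BA≈I x k =
  trans (transpose-·ᵥ-·ₘ A B x k)
        (trans (sumF2-cong (λ i → cong (_∧ x i) (BA≈I i k))) (sumF2-idMat k x))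

transpose-inverse-⇔ : (M Minv : F2Mat r) → IsInverse M Minv → (a y : F2Vec r) →
  (transpose M ·ᵥ y ≗ a) ⇔ (y ≗ transpose Minv ·ᵥ a)
transpose-inverse-⇔ M Minv (MMinv≈I , MinvM≈I) a y = mk⇔
  (λ Mᵀy≗a k → trans (sym (transpose-·ᵥ-cancel Minv M MMinv≈I y k)) (·ᵥ-cong (transpose Minv) Mᵀy≗a k))
  (λ y≗Minvᵀa k → trans (·ᵥ-cong (transpose M) y≗Minvᵀa k) (transpose-·ᵥ-cancel M Minv MinvM≈I a k))

incidence : (Fin r → Subset n) → Fin n → F2Vec r
incidence X s i = lookup (X i) s

≗-respˡ-⇔ : {f g h : F2Vec r} → f ≗ g → (f ≗ h) ⇔ (g ≗ h)
≗-respˡ-⇔ f≗g = mk⇔ (λ f≗h i → trans (sym (f≗g i)) (f≗h i)) (λ g≗h i → trans (f≗g i) (g≗h i))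

lookup-z : (X : Fin r → Subset n) (b : F2Vec r) (s : Fin n) →
  lookup (z X b) s ≡ sumF2 (λ i → b i ∧ incidence X s i)
lookup-z {r = ℕ.zero}  X b s = lookup-replicate s false
lookup-z {r = ℕ.suc r} X b s =
  trans (lookup-zipWith _xor_ s (if b zero then X zero else Subset.⊥) (z (X ∘ suc) (b ∘ suc)))
        (cong₂ _xor_ (lookup-if (b zero)) (lookup-z (X ∘ suc) (b ∘ suc) s))
  where
  lookup-if : ∀ c → lookup (if c then X zero else Subset.⊥) s ≡ c ∧ lookup (X zero) s
  lookup-if true  = refl
  lookup-if false = lookup-replicate s false

∧-≡-true : ∀ {x y} → x ∧ y ≡ true ⇔ (x ≡ true × y ≡ true)
∧-≡-true {true}  {true}  = mk⇔ (λ _ → refl , refl) (λ _ → refl)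
∧-≡-true {true}  {false} = mk⇔ (λ ()) (λ ())
∧-≡-true {false} {y}     = mk⇔ (λ ()) (λ ())

not-≡-true : ∀ {x} → not x ≡ true ⇔ x ≡ false
not-≡-true {true}  = mk⇔ (λ ()) (λ ())
not-≡-true {false} = mk⇔ (λ _ → refl) (λ _ → refl)

lookup-v : (X : Fin r → Subset n) (a : F2Vec r) (s : Fin n) →
  lookup (v X a) s ≡ true ⇔ incidence X s ≗ a
lookup-v {r = ℕ.zero}  X a s = mk⇔ (λ _ ()) (λ _ → lookup-replicate s true)
lookup-v {r = ℕ.suc r} X a s = begin
  lookup (v X a) s ≡ true                           ∼⟨ ≡-true-cong (lookup-zipWith _∧_ s region₀ regions) ⟩
  lookup region₀ s ∧ lookup regions s ≡ true        ∼⟨ ∧-≡-true ⟩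
  (lookup region₀ s ≡ true × lookup regions s ≡ true)
    ∼⟨ lookup-region₀ (a zero) ×-⇔ lookup-v (X ∘ suc) (a ∘ suc) s ⟩
  (incidence X s zero ≡ a zero × (incidence X s ∘ suc) ≗ (a ∘ suc))
    ∼⟨ ∀-cons-⇔ ⟩
  incidence X s ≗ a                                 ∎
  where
  open EquationalReasoning
  region₀ = if a zero then X zero else Subset.∁ (X zero)
  regions = v (X ∘ suc) (a ∘ suc)
  ≡-true-cong : ∀ {p q : Bool} → p ≡ q → (p ≡ true) ⇔ (q ≡ true)
  ≡-true-cong p≡q = mk⇔ (trans (sym p≡q)) (trans p≡q)
  lookup-region₀ : ∀ c → lookup (if c then X zero else Subset.∁ (X zero)) s ≡ true ⇔ lookup (X zero) s ≡ c
  lookup-region₀ true  = mk⇔ (λ h → h) (λ h → h)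
  lookup-region₀ false = not-≡-true ⇔-∘ ≡-true-cong (lookup-map s not (X zero))

incidence-change-of-basis : (X Y : Fin r → Subset n) (M : F2Mat r) →
  (∀ b → z X b ≡ z Y (M ·ᵥ b)) → ∀ s → incidence X s ≗ transpose M ·ᵥ incidence Y s
incidence-change-of-basis X Y M hz s j = begin
  incidence X s j                                   ≡⟨ sym (sumF2-idMat j (incidence X s)) ⟩
  sumF2 (λ i → eⱼ i ∧ incidence X s i)              ≡⟨ sym (lookup-z X eⱼ s) ⟩
  lookup (z X eⱼ) s                                 ≡⟨ cong (λ A → lookup A s) (hz eⱼ) ⟩
  lookup (z Y (M ·ᵥ eⱼ)) s                          ≡⟨ lookup-z Y (M ·ᵥ eⱼ) s ⟩
  sumF2 (λ i → (M ·ᵥ eⱼ) i ∧ incidence Y s i)       ≡⟨ sumF2-cong (λ i → cong (_∧ incidence Y s i) (M·eⱼ i)) ⟩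
  sumF2 (λ i → M i j ∧ incidence Y s i)             ∎
  where
  open ≡-Reasoning
  eⱼ : F2Vec _
  eⱼ i = idMat i j
  M·eⱼ : ∀ i → (M ·ᵥ eⱼ) i ≡ M i j
  M·eⱼ i = trans (sumF2-cong (λ k → ∧-comm (M i k) (eⱼ k))) (sumF2-idMat j (M i))

theorem3p16 : (n r : ℕ) (V : Subset n → Set) → IsSubspace V →
    (X Y : Fin r → Subset n) → IsBasis V X → IsBasis V Y →
    (M Minv : F2Mat r) → IsInverse M Minv →
    (∀ (b : F2Vec r) → z X b ≡ z Y (M ·ᵥ b)) →
    ∀ (a : F2Vec r) → v X a ≡ v Y (transpose Minv ·ᵥ a)
theorem3p16 _ _ _ _ X Y _ _ M Minv M⁻¹ hz a = Pointwise-≡⇒≡ (ext (λ s → ⇔→≡ (same-region s)))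
  where
  open EquationalReasoning
  same-region : ∀ s → lookup (v X a) s ≡ true ⇔ lookup (v Y (transpose Minv ·ᵥ a)) s ≡ true
  same-region s = begin
    lookup (v X a) s ≡ true                            ∼⟨ lookup-v X a s ⟩
    incidence X s ≗ a                                  ∼⟨ ≗-respˡ-⇔ x≗Mᵀy ⟩
    transpose M ·ᵥ incidence Y s ≗ a                   ∼⟨ transpose-inverse-⇔ M Minv M⁻¹ a (incidence Y s) ⟩
    incidence Y s ≗ transpose Minv ·ᵥ a                ∼⟨ ⇔-sym (lookup-v Y _ s) ⟩
    lookup (v Y (transpose Minv ·ᵥ a)) s ≡ true ∎
    where
    x≗Mᵀy = incidence-change-of-basis X Y M hz s
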